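{- Let $t\ge 1$ and $\pi\in\mathfrak{S}_n(321)$. Then $\pi$ is $t$-stack-sortable if and only if $\mathsf{mlw}(\pi)\le t$.
   Context: $\mathfrak{S}_n(321)$ is the set of permutations of $[n]$ with no decreasing subsequence of length 3. The stack-sorting map $\mathcal{S}$ is defined recursively on words with distinct letters by $\mathcal{S}(\emptyset)=\emptyset$ and, writing $w=\alpha\, m\,\beta$ with $m$ the largest letter, $\mathcal{S}(w)=\mathcal{S}(\alpha)\mathcal{S}(\beta)m$; $\pi$ is $t$-stack-sortable if $\mathcal{S}^t(\pi)$ is the identity. A letter $\pi_j$ is a right-to-left minimum of $\pi$ if $\pi_j<\pi_k$ for all $k>j$; $\mathsf{Rmi}(\pi)$ is the set of these. For $\pi\in\mathfrak{S}_n(321)$, $\mathsf{mlw}(\pi)=\max_{\pi_j\in\mathsf{Rmi}(\pi)}(j-\pi_j)$. -}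

module Defs where

open import Data.Nat using (ℕ; zero; suc; _+_; _∸_; _<_; _≤_; _⊔_; _<ᵇ_)
open import Data.Bool using (Bool; true; false; if_then_else_; _∧_)
open import Data.List using (List; []; _∷_; _++_; length; map; upTo; foldr)
open import Data.List.Relation.Binary.Permutation.Propositional using (_↭_)
open import Relation.Binary.PropositionalEquality using (_≡_)
open import Data.Product using (_×_; _,_; proj₁; proj₂)
open import Data.Empty using (⊥)

idPerm : ℕ → List ℕ
idPerm n = map suc (upTo n)

-- π is a permutation of [n], written in one-line notation as a list
IsPerm : ℕ → List ℕ → Set
IsPerm n π = π ↭ idPerm n

-- π_i (1-indexed) ; positions are 1..length π
-- Occurrence of a decreasing subsequence of length 3: positions i<j<k with π_i>π_j>π_k
data At : List ℕ → ℕ → ℕ → Set where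
  here  : ∀ {x xs} → At (x ∷ xs) 1 x
  there : ∀ {x xs i y} → At xs i y → At (x ∷ xs) (suc i) y

Avoids321 : List ℕ → Set
Avoids321 π = ∀ {i j k a b c} → At π i a → At π j b → At π k c →
  i < j → j < k → b < a → c < b → ⊥

S321 : ℕ → List ℕ → Set
S321 n π = IsPerm n π × Avoids321 π

-- maximum of a list (0 for the empty list)
maxL : List ℕ → ℕ
maxL = foldr _⊔_ 0

splitMax : List ℕ → List ℕ × List ℕ
splitMax [] = [] , []
splitMax (x ∷ xs) with maxL xs <ᵇ x
... | true  = [] , xs
... | false = (x ∷ proj₁ (splitMax xs)) , proj₂ (splitMax xs)

stackSortF : ℕ → List ℕ → List ℕ
stackSortF zero    w        = w
stackSortF (suc f) []       = []
stackSortF (suc f) (x ∷ xs) =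
  let m = maxL (x ∷ xs)
      p = splitMax (x ∷ xs)
  in stackSortF f (proj₁ p) ++ stackSortF f (proj₂ p) ++ (m ∷ [])

-- S(w) for a word with distinct letters (fuel = length w is enough: each
-- recursive call is on a strictly shorter word)
S : List ℕ → List ℕ
S w = stackSortF (length w) w

iterate : ℕ → (List ℕ → List ℕ) → List ℕ → List ℕ
iterate zero    g w = w
iterate (suc t) g w = iterate t g (g w)

StackSortable : ℕ → ℕ → List ℕ → Set
StackSortable n t π = iterate t S π ≡ idPerm n

isRmin : ℕ → List ℕ → Bool
isRmin x []         = true
isRmin x (y ∷ rest) = (x <ᵇ y) ∧ isRmin x rest

-- mlw π = max over right-to-left minima π_j of (j - π_j)   (j is 1-indexed);
-- for π a permutation of [n], every RL-minimum satisfies π_j ≤ j, so ∸ is exact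
mlwFrom : ℕ → List ℕ → ℕ
mlwFrom j []       = 0
mlwFrom j (x ∷ xs) =
  (if isRmin x xs then j ∸ x else 0) ⊔ mlwFrom (suc j) xs

mlw : List ℕ → ℕ
mlw π = mlwFrom 1 π

-- For a letter b of a word w let largerBefore b w count the letters larger than b to its
-- left. In a 321-avoiding word every letter with a larger letter to its left is a
-- right-to-left minimum; with this one checks that a stack-sorting pass
-- S(α m β) = S(α) S(β) m lowers every largerBefore by exactly one (stopping at 0) and keeps
-- the word 321-avoiding. A word of distinct letters is increasing iff all its largerBefore
-- vanish, so π is t-stack-sortable iff largerBefore b π ≤ t for every letter b.
-- If b = π_j is a right-to-left minimum, its b − 1 smaller letters all precede it, so
-- largerBefore b π = j − b; otherwise a smaller letter follows b and 321-avoidance forces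
-- largerBefore b π = 0. Hence the largest largerBefore is mlw π.
module Submission where

open import Defs
open import Relation.Binary.PropositionalEquality
open import Data.Nat using (ℕ; zero; suc; _+_; _∸_; _≤_; _<_; _≥_; _⊔_; _<ᵇ_; z≤n; s≤s; _≟_; _<?_; _≤?_)
open import Data.Bool using (true; false; T; _∧_; if_then_else_)
open import Data.Empty using (⊥-elim)
open import Data.List using (List; []; _∷_; _++_; length; map; upTo; filter)
open import Data.List.Properties
  using (++-assoc; ∷-injective; length-++; filter-++; filter-all; filter-none;
         filter-accept; filter-reject; map-++; length-map; length-upTo; upTo-∷ʳ)
open import Data.List.Membership.Propositional using (_∈_; _∉_; find)
open import Data.List.Membership.Propositional.Properties using (∈-++⁺ʳ; ∈-++⁻; ∈-map⁻; ∈-upTo⁻)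
open import Data.List.Membership.DecPropositional _≟_ using (_∈?_)
open import Data.List.Relation.Binary.Permutation.Propositional
  using (_↭_; ↭-refl; ↭-sym; ↭-trans; ↭-reflexive; ↭⇒↭ₛ)
open import Data.List.Relation.Binary.Permutation.Propositional.Properties
  using (All-resp-↭; ∈-resp-↭; ↭-length; filter-↭; ∷↭∷ʳ)
  renaming (++⁺ to ↭-++⁺; ++⁺ʳ to ↭-++⁺ʳ)
open import Data.List.Relation.Binary.Permutation.Setoid.Properties (setoid ℕ)
  using () renaming (Unique-resp-↭ to Unique-resp-↭ₛ)
open import Data.List.Relation.Binary.Pointwise using (Pointwise-≡⇒≡)
open import Data.List.Relation.Unary.All as All using (All; []; _∷_; all?)
import Data.List.Relation.Unary.All.Properties as Allₚ
open import Data.List.Relation.Unary.AllPairs as AllPairs using (AllPairs; []; _∷_)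
import Data.List.Relation.Unary.AllPairs.Properties as AllPairsₚ
open import Data.List.Relation.Unary.Any using (Any; here; there)
import Data.List.Relation.Unary.Any.Properties as Anyₚ
open import Data.List.Relation.Unary.Linked.Properties using (AllPairs⇒Linked)
open import Data.List.Relation.Unary.Sorted.TotalOrder.Properties using (↗↭↗⇒≋)
open import Data.List.Relation.Unary.Unique.Propositional using (Unique)
open import Data.Nat.Properties
open import Data.Product using (_×_; _,_; proj₁; proj₂; ∃; ∃₂)
open import Data.Sum using (_⊎_; inj₁; inj₂)
open import Data.Unit using (tt)
open import Function using (id; _∘_)
open import Function.Bundles using (_⇔_; mk⇔; Equivalence)
import Function.Properties.Equivalence as ⇔
open import Relation.Nullary using (¬_; yes; no; does; contradiction)
open import Relation.Binary using (tri<; tri≈; tri>)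
open import Relation.Unary using (Decidable)

private
  variable
    b m n t x : ℕ
    w xs ys p s l r : List ℕ

++-∷-split : ∀ xs {ys p s} → xs ++ ys ≡ p ++ b ∷ s →
  (∃ λ s′ → xs ≡ p ++ b ∷ s′ × s ≡ s′ ++ ys) ⊎ (∃ λ p′ → ys ≡ p′ ++ b ∷ s × p ≡ xs ++ p′)
++-∷-split []       {p = p}     eq   = inj₂ (p , eq , refl)
++-∷-split (x ∷ xs) {p = []}    refl = inj₁ (xs , refl , refl)
++-∷-split (x ∷ xs) {p = y ∷ p} eq   with ∷-injective eq
... | refl , eq′ with ++-∷-split xs eq′
...   | inj₁ (s′ , refl , refl) = inj₁ (s′ , refl , refl)
...   | inj₂ (p′ , refl , refl) = inj₂ (p′ , refl , refl)

module _ {R : ℕ → ℕ → Set} where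

  AllPairs-++⁻ˡ : ∀ xs → AllPairs R (xs ++ ys) → AllPairs R xs
  AllPairs-++⁻ˡ []       _        = []
  AllPairs-++⁻ˡ (x ∷ xs) (h ∷ hs) = Allₚ.++⁻ˡ xs h ∷ AllPairs-++⁻ˡ xs hs

  AllPairs-++⁻ʳ : ∀ xs → AllPairs R (xs ++ ys) → AllPairs R ys
  AllPairs-++⁻ʳ []       hs       = hs
  AllPairs-++⁻ʳ (x ∷ xs) (_ ∷ hs) = AllPairs-++⁻ʳ xs hs

  AllPairs-∷⁻ : ∀ p → AllPairs R (p ++ b ∷ s) → All (R b) s
  AllPairs-∷⁻ []      (h ∷ _)  = h
  AllPairs-∷⁻ (x ∷ p) (_ ∷ hs) = AllPairs-∷⁻ p hs

  AllPairs-fromSplits : ∀ xs → (∀ p b s → xs ≡ p ++ b ∷ s → All (R b) s) → AllPairs R xs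
  AllPairs-fromSplits []       _ = []
  AllPairs-fromSplits (x ∷ xs) h =
    h [] x xs refl ∷ AllPairs-fromSplits xs (λ p b s eq → h (x ∷ p) b s (cong (x ∷_) eq))

Unique-∷⁻ : ∀ p → Unique (p ++ b ∷ s) → b ∉ p
Unique-∷⁻ (x ∷ p) (x≢ ∷ _) (here refl)   = All.lookup x≢ (∈-++⁺ʳ p (here refl)) refl
Unique-∷⁻ (x ∷ p) (_ ∷ u)  (there b∈p) = Unique-∷⁻ p u b∈p

Unique-resp-↭ : xs ↭ ys → Unique xs → Unique ys
Unique-resp-↭ xs↭ys = Unique-resp-↭ₛ (↭⇒↭ₛ xs↭ys)

sorted-↭⇒≡ : AllPairs _≤_ xs → AllPairs _≤_ ys → xs ↭ ys → xs ≡ ys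
sorted-↭⇒≡ xs↗ ys↗ xs↭ys =
  Pointwise-≡⇒≡ (↗↭↗⇒≋ ≤-totalOrder (AllPairs⇒Linked xs↗) (AllPairs⇒Linked ys↗) (↭⇒↭ₛ xs↭ys))

≤-maxL : x ∈ xs → x ≤ maxL xs
≤-maxL {xs = y ∷ xs} (here refl) = m≤m⊔n y (maxL xs)
≤-maxL {xs = y ∷ xs} (there x∈) = ≤-trans (≤-maxL x∈) (m≤n⊔m y (maxL xs))

module _ {P : ℕ → Set} (P? : Decidable P) where

  count-++ : ∀ xs ys → length (filter P? (xs ++ ys)) ≡ length (filter P? xs) + length (filter P? ys)
  count-++ xs ys = trans (cong length (filter-++ P? xs ys)) (length-++ (filter P? xs))

  count-↭ : xs ↭ ys → length (filter P? xs) ≡ length (filter P? ys)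
  count-↭ xs↭ys = ↭-length (filter-↭ P? xs↭ys)

  count-none : All (¬_ ∘ P) xs → length (filter P? xs) ≡ 0
  count-none h = cong length (filter-none P? h)

  count>0⇒Any : ∀ xs → 0 < length (filter P? xs) → Any P xs
  count>0⇒Any (x ∷ xs) c with P? x
  ... | yes px = here px
  ... | no  _  = there (count>0⇒Any xs c)

  Any⇒count>0 : Any P xs → 0 < length (filter P? xs)
  Any⇒count>0 {x ∷ xs} a with P? x | a
  ... | yes _  | _          = s≤s z≤n
  ... | no ¬px | here px    = contradiction px ¬px
  ... | no _   | there a′   = Any⇒count>0 a′

countAbove countBelow : ℕ → List ℕ → ℕ
countAbove b xs = length (filter (b <?_) xs)
countBelow b xs = length (filter (_<? b) xs)

length≡countBelow+countAbove : ∀ xs → b ∉ xs → length xs ≡ countBelow b xs + countAbove b xs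
length≡countBelow+countAbove     []       _  = refl
length≡countBelow+countAbove {b} (x ∷ xs) b∉ with <-cmp x b | length≡countBelow+countAbove xs (b∉ ∘ there)
... | tri< x<b _ x≯b | ih
  rewrite filter-accept (_<? b) {xs = xs} x<b | filter-reject (b <?_) {xs = xs} x≯b = cong suc ih
... | tri≈ _ x≡b _   | _  = ⊥-elim (b∉ (here (sym x≡b)))
... | tri> x≮b _ b<x | ih
  rewrite filter-reject (_<? b) {xs = xs} x≮b | filter-accept (b <?_) {xs = xs} b<x =
  trans (cong suc ih) (sym (+-suc (countBelow b xs) (countAbove b xs)))

before : ℕ → List ℕ → List ℕ
before b []       = []
before b (x ∷ xs) with x ≟ b
... | yes _ = []
... | no  _ = x ∷ before b xs

largerBefore : ℕ → List ℕ → ℕ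
largerBefore b w = countAbove b (before b w)

before-++-∉ : ∀ p s → b ∉ p → before b (p ++ s) ≡ p ++ before b s
before-++-∉     []      s _  = refl
before-++-∉ {b} (x ∷ p) s b∉ with x ≟ b
... | yes refl = ⊥-elim (b∉ (here refl))
... | no  _    = cong (x ∷_) (before-++-∉ p s (b∉ ∘ there))

before-++-∈ : ∀ p s → b ∈ p → before b (p ++ s) ≡ before b p
before-++-∈ {b} (x ∷ p) s b∈ with x ≟ b | b∈
... | yes _   | _           = refl
... | no  x≢b | here b≡x    = ⊥-elim (x≢b (sym b≡x))
... | no  _   | there b∈p   = cong (x ∷_) (before-++-∈ p s b∈p)

before-∷ : ∀ b s → before b (b ∷ s) ≡ []
before-∷ b s with b ≟ b
... | yes _   = refl
... | no  b≢b = ⊥-elim (b≢b refl)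

before-split : ∀ w → b ∈ w → ∃ λ s → w ≡ before b w ++ b ∷ s
before-split {b} (x ∷ w) b∈ with x ≟ b | b∈
... | yes refl | _         = w , refl
... | no  x≢b  | here b≡x  = ⊥-elim (x≢b (sym b≡x))
... | no  _    | there b∈w = let s , eq = before-split w b∈w in s , cong (x ∷_) eq

largerBefore-++-∉ : ∀ p s → b ∉ p → largerBefore b (p ++ s) ≡ countAbove b p + largerBefore b s
largerBefore-++-∉ {b} p s b∉ =
  trans (cong (countAbove b) (before-++-∉ p s b∉)) (count-++ (b <?_) p (before b s))

largerBefore-++-∈ : ∀ p s → b ∈ p → largerBefore b (p ++ s) ≡ largerBefore b p
largerBefore-++-∈ {b} p s b∈ = cong (countAbove b) (before-++-∈ p s b∈)

largerBefore-∷ : ∀ b s → largerBefore b (b ∷ s) ≡ 0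
largerBefore-∷ b s = cong (countAbove b) (before-∷ b s)

largerBefore-++-∷ : ∀ p s → b ∉ p → largerBefore b (p ++ b ∷ s) ≡ countAbove b p
largerBefore-++-∷ {b} p s b∉ = begin
  largerBefore b (p ++ b ∷ s)               ≡⟨ largerBefore-++-∉ p (b ∷ s) b∉ ⟩
  countAbove b p + largerBefore b (b ∷ s)   ≡⟨ cong (countAbove b p +_) (largerBefore-∷ b s) ⟩
  countAbove b p + 0                        ≡⟨ +-identityʳ _ ⟩
  countAbove b p                            ∎
  where open ≡-Reasoning

dominated-split : ∀ w → b ∈ w → 0 < largerBefore b w → ∃₂ λ p s → w ≡ p ++ b ∷ s × Any (b <_) p
dominated-split {b} w b∈ pos =
  let s , eq = before-split w b∈ in before b w , s , eq , count>0⇒Any (b <?_) (before b w) pos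

largerBefore-sorted : ∀ w → AllPairs _≤_ w → b ∈ w → largerBefore b w ≡ 0
largerBefore-sorted {b} (x ∷ w) (x≤ ∷ w↗) b∈ with x ≟ b | b∈
... | yes _   | _          = refl
... | no  x≢b | here b≡x   = ⊥-elim (x≢b (sym b≡x))
... | no  _   | there b∈w
  rewrite filter-reject (b <?_) {xs = before b w} (≤⇒≯ (All.lookup x≤ b∈w)) = largerBefore-sorted w w↗ b∈w

largerBefore≡0⇒sorted : ∀ w → Unique w → (∀ {b} → b ∈ w → largerBefore b w ≡ 0) → AllPairs _≤_ w
largerBefore≡0⇒sorted []       _          _    = []
largerBefore≡0⇒sorted (x ∷ w) (x≢ ∷ w-uniq) vanish =
  All.tabulate x≤ ∷ largerBefore≡0⇒sorted w w-uniq (λ y∈ → m+n≡0⇒n≡0 _ (split-at y∈))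
  where
  split-at : ∀ {y} → y ∈ w → countAbove y (x ∷ []) + largerBefore y w ≡ 0
  split-at {y} y∈ =
    trans (sym (largerBefore-++-∉ (x ∷ []) w λ { (here y≡x) → All.lookup x≢ y∈ (sym y≡x) })) (vanish (there y∈))
  x≤ : ∀ {y} → y ∈ w → x ≤ y
  x≤ y∈ = ≮⇒≥ λ y<x → <⇒≢ (Any⇒count>0 (_ <?_) (here y<x)) (sym (m+n≡0⇒m≡0 _ (split-at y∈)))

idPerm-suc : ∀ n → idPerm (suc n) ≡ idPerm n ++ suc n ∷ []
idPerm-suc n = trans (cong (map suc) (sym (upTo-∷ʳ n))) (map-++ suc (upTo n) (n ∷ []))

length-idPerm : ∀ n → length (idPerm n) ≡ n
length-idPerm n = trans (length-map suc (upTo n)) (length-upTo n)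

∈-idPerm⁻ : x ∈ idPerm n → 0 < x × x ≤ n
∈-idPerm⁻ x∈ with ∈-map⁻ suc x∈
... | _ , y∈ , refl = s≤s z≤n , ∈-upTo⁻ y∈

idPerm-strictlySorted : ∀ n → AllPairs _<_ (idPerm n)
idPerm-strictlySorted n = AllPairsₚ.map⁺ (AllPairsₚ.applyUpTo⁺₁ id n (λ i<j _ → s≤s i<j))

countBelow-idPerm : ∀ n → x ≤ suc n → countBelow x (idPerm n) ≡ x ∸ 1
countBelow-idPerm zero x≤1 = sym (m≤n⇒m∸n≡0 x≤1)
countBelow-idPerm {x} (suc n) x≤ = begin
  countBelow x (idPerm (suc n))                         ≡⟨ cong (countBelow x) (idPerm-suc n) ⟩
  countBelow x (idPerm n ++ suc n ∷ [])                 ≡⟨ count-++ (_<? x) (idPerm n) (suc n ∷ []) ⟩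
  countBelow x (idPerm n) + countBelow x (suc n ∷ [])   ≡⟨ last x≤ ⟩
  x ∸ 1                                                 ∎
  where
  open ≡-Reasoning
  last : x ≤ suc (suc n) → countBelow x (idPerm n) + countBelow x (suc n ∷ []) ≡ x ∸ 1
  last x≤ with x ≤? suc n
  ... | yes x≤1+n rewrite filter-reject (_<? x) {xs = []} (≤⇒≯ x≤1+n) =
    trans (+-identityʳ _) (countBelow-idPerm n x≤1+n)
  ... | no x≰1+n with refl ← ≤-antisym x≤ (≰⇒> x≰1+n)
    rewrite filter-accept (_<? x) {xs = []} (n<1+n (suc n)) =
    trans (+-comm _ 1) (cong suc (trans (cong length (filter-all (_<? x) below)) (length-idPerm n)))
    where
    below : All (_< x) (idPerm n)
    below = All.tabulate λ y∈ → s≤s (m≤n⇒m≤1+n (proj₂ (∈-idPerm⁻ y∈)))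

-- 321-avoidance in the form used throughout: every letter with a larger letter to its
-- left is a right-to-left minimum.
DominatedBelowLater : List ℕ → Set
DominatedBelowLater w = ∀ p b s → w ≡ p ++ b ∷ s → Any (b <_) p → All (b ≤_) s

∈⇒At : x ∈ xs → ∃ λ i → At xs (suc i) x
∈⇒At (here refl) = 0 , here
∈⇒At (there x∈)  = let i , at = ∈⇒At x∈ in suc i , there at

At-≤length : ∀ {i} → At xs i x → i ≤ length xs
At-≤length here       = s≤s z≤n
At-≤length (there at) = s≤s (At-≤length at)

At-++ˡ : ∀ {i} → At xs i x → At (xs ++ ys) i x
At-++ˡ here       = here
At-++ˡ (there at) = there (At-++ˡ at)

At-++ʳ : ∀ xs {i} → At ys i x → At (xs ++ ys) (length xs + i) x
At-++ʳ []       at = at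
At-++ʳ (y ∷ xs) at = there (At-++ʳ xs at)

Avoids321⇒DominatedBelowLater : ∀ w → Avoids321 w → DominatedBelowLater w
Avoids321⇒DominatedBelowLater _ avoids p b s refl larger = All.tabulate λ {c} c∈ → ≮⇒≥ λ c<b →
  let a , a∈ , b<a = find larger
      i , at-a     = ∈⇒At a∈
      k , at-c     = ∈⇒At c∈
  in avoids (At-++ˡ at-a) (At-++ʳ p (here {x = b})) (At-++ʳ p (there at-c))
            (≤-<-trans (At-≤length at-a) (m<m+n (length p) (s≤s z≤n)))
            (+-monoʳ-< (length p) (s≤s (s≤s z≤n))) b<a c<b

DominatedBelowLater-++⁻ˡ : ∀ xs → DominatedBelowLater (xs ++ ys) → DominatedBelowLater xs
DominatedBelowLater-++⁻ˡ {ys} _ dom p b s refl larger =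
  Allₚ.++⁻ˡ s (dom p b (s ++ ys) (++-assoc p (b ∷ s) ys) larger)

DominatedBelowLater-++⁻ʳ : ∀ xs → DominatedBelowLater (xs ++ ys) → DominatedBelowLater ys
DominatedBelowLater-++⁻ʳ xs dom p b s refl larger =
  dom (xs ++ p) b s (sym (++-assoc xs p (b ∷ s))) (Anyₚ.++⁺ʳ xs larger)

sorted⇒DominatedBelowLater : ∀ w → AllPairs _≤_ w → DominatedBelowLater w
sorted⇒DominatedBelowLater _ w↗ p b s refl _ = AllPairs-∷⁻ p w↗

DominatedBelowLater-++ : ∀ xs → DominatedBelowLater xs →
  (∀ p b s → xs ≡ p ++ b ∷ s → Any (b <_) p → All (b ≤_) ys) →
  AllPairs _≤_ ys → DominatedBelowLater (xs ++ ys)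
DominatedBelowLater-++ {ys} xs dom cross ys↗ p b s eq larger with ++-∷-split xs eq
... | inj₁ (s′ , refl , refl) = Allₚ.++⁺ (dom p b s′ refl larger) (cross p b s′ refl larger)
... | inj₂ (p′ , refl , _)    = AllPairs-∷⁻ p′ ys↗

DominatedBelowLater⇒sortedBelowPeak : ∀ l → DominatedBelowLater (l ++ m ∷ r) → All (_< m) r → AllPairs _≤_ r
DominatedBelowLater⇒sortedBelowPeak {m} {r} l dom r<m = AllPairs-fromSplits r λ where
  q b s refl → dom (l ++ m ∷ q) b s (sym (++-assoc l (m ∷ q) (b ∷ s)))
                   (Anyₚ.++⁺ʳ l (here (All.lookup r<m (∈-++⁺ʳ q (here refl)))))

-- splitMax takes 0 as the maximum of the empty word, so it is correct only on positive letters.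
splitMax-correct : ∀ x xs → 0 < x → All (0 <_) xs →
  x ∷ xs ≡ proj₁ (splitMax (x ∷ xs)) ++ maxL (x ∷ xs) ∷ proj₂ (splitMax (x ∷ xs))
  × All (_< maxL (x ∷ xs)) (proj₂ (splitMax (x ∷ xs)))
splitMax-correct x xs 0<x 0<xs with maxL xs <ᵇ x in eq
... | true =
  cong (_∷ xs) (sym x⊔≡x) , All.tabulate λ y∈ → subst (_ <_) (sym x⊔≡x) (≤-<-trans (≤-maxL y∈) max<x)
  where
  max<x : maxL xs < x
  max<x = <ᵇ⇒< (maxL xs) x (subst T (sym eq) tt)
  x⊔≡x : x ⊔ maxL xs ≡ x
  x⊔≡x = m≥n⇒m⊔n≡m (<⇒≤ max<x)
splitMax-correct (suc x) [] _ _ | false with () ← eq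
splitMax-correct x (y ∷ ys) _ (0<y ∷ 0<ys) | false with splitMax-correct y ys 0<y 0<ys
... | split , right< = cong (x ∷_) (subst (λ k → y ∷ ys ≡ _ ++ k ∷ _) (sym x⊔≡max) split) ,
                       subst (λ k → All (_< k) _) (sym x⊔≡max) right<
  where
  x≤max : x ≤ maxL (y ∷ ys)
  x≤max = ≮⇒≥ λ max<x → subst T eq (<⇒<ᵇ max<x)
  x⊔≡max : x ⊔ maxL (y ∷ ys) ≡ maxL (y ∷ ys)
  x⊔≡max = m≤n⇒m⊔n≡n x≤max

record PeakSplit (w : List ℕ) : Set where
  field
    left  : List ℕ
    peak  : ℕ
    right : List ℕ
    split      : w ≡ left ++ peak ∷ right
    left≤peak  : All (_≤ peak) left
    right<peak : All (_< peak) right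

  All-left : ∀ {P : ℕ → Set} → All P w → All P left
  All-left h = Allₚ.++⁻ˡ left (subst (All _) split h)

  All-right : ∀ {P : ℕ → Set} → All P w → All P right
  All-right h = All.tail (Allₚ.++⁻ʳ left (subst (All _) split h))

  Unique-left : Unique w → Unique left
  Unique-left u = AllPairs-++⁻ˡ left (subst Unique split u)

  Unique-right : Unique w → Unique right
  Unique-right u = AllPairs.tail (AllPairs-++⁻ʳ left (subst Unique split u))

  dominated-left : DominatedBelowLater w → DominatedBelowLater left
  dominated-left dom = DominatedBelowLater-++⁻ˡ left (subst DominatedBelowLater split dom)

  dominated-right : DominatedBelowLater w → DominatedBelowLater right
  dominated-right dom = DominatedBelowLater-++⁻ʳ (peak ∷ [])
    (DominatedBelowLater-++⁻ʳ left (subst DominatedBelowLater split dom))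

  length-split : length w ≡ suc (length left + length right)
  length-split = trans (cong length split) (trans (length-++ left) (+-suc _ _))

  left+right-shorter : ∀ {f} → length w ≤ suc f → length left + length right ≤ f
  left+right-shorter w≤ = ≤-pred (subst (_≤ _) length-split w≤)

  left-shorter : ∀ {f} → length w ≤ suc f → length left ≤ f
  left-shorter = ≤-trans (m≤m+n _ _) ∘ left+right-shorter

  right-shorter : ∀ {f} → length w ≤ suc f → length right ≤ f
  right-shorter = ≤-trans (m≤n+m _ _) ∘ left+right-shorter

peakSplit : ∀ x xs → All (0 <_) (x ∷ xs) → PeakSplit (x ∷ xs)
peakSplit x xs pos = record
  { left       = proj₁ (splitMax (x ∷ xs))
  ; peak       = maxL (x ∷ xs)
  ; right      = proj₂ (splitMax (x ∷ xs))
  ; split      = proj₁ correct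
  ; left≤peak  = All.tabulate λ y∈ → ≤-maxL (subst (_ ∈_) (sym (proj₁ correct)) (Anyₚ.++⁺ˡ y∈))
  ; right<peak = proj₂ correct
  }
  where correct = splitMax-correct x xs (All.head pos) (All.tail pos)

peak-↭ : ∀ {Sl Sr} → Sl ↭ l → Sr ↭ r → Sl ++ Sr ++ m ∷ [] ↭ l ++ m ∷ r
peak-↭ {r = r} {m = m} Sl↭l Sr↭r = ↭-++⁺ Sl↭l (↭-trans (↭-++⁺ʳ (m ∷ []) Sr↭r) (↭-sym (∷↭∷ʳ m r)))

largerBefore-peak-right : ∀ {Sr} → DominatedBelowLater (l ++ m ∷ r) →
  All (_≤ m) l → All (_< m) r → Sr ↭ r →
  (∀ {b} → b ∈ r → largerBefore b Sr ≡ largerBefore b r ∸ 1) →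
  b ∈ m ∷ r → countAbove b l + largerBefore b (Sr ++ m ∷ []) ≡ (countAbove b l + largerBefore b (m ∷ r)) ∸ 1
largerBefore-peak-right {l} {m} {r} {Sr = Sr} dom l≤m r<m Sr↭r ih-r (here refl) = begin
  countAbove m l + largerBefore m (Sr ++ m ∷ [])  ≡⟨ cong₂ _+_ nothing-above-l nothing-above-Sr ⟩
  0                                               ≡⟨ cong₂ (λ i j → (i + j) ∸ 1) nothing-above-l (largerBefore-∷ m r) ⟨
  (countAbove m l + largerBefore m (m ∷ r)) ∸ 1   ∎
  where
  open ≡-Reasoning
  nothing-above-l : countAbove m l ≡ 0
  nothing-above-l = count-none (m <?_) (All.map ≤⇒≯ l≤m)
  m∉Sr : m ∉ Sr
  m∉Sr m∈ = <-irrefl refl (All.lookup r<m (∈-resp-↭ Sr↭r m∈))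
  nothing-above-Sr : largerBefore m (Sr ++ m ∷ []) ≡ 0
  nothing-above-Sr = trans (largerBefore-++-∷ Sr [] m∉Sr)
    (trans (count-↭ (m <?_) Sr↭r) (count-none (m <?_) (All.map <⇒≯ r<m)))
largerBefore-peak-right {l} {m} {r} {b} {Sr} dom l≤m r<m Sr↭r ih-r (there b∈r) = begin
  countAbove b l + largerBefore b (Sr ++ m ∷ [])  ≡⟨ cong (countAbove b l +_) none-in-Sr ⟩
  countAbove b l + 0                              ≡⟨ +-identityʳ _ ⟩
  countAbove b l                                  ≡⟨ m+n∸n≡m _ 1 ⟨
  (countAbove b l + 1) ∸ 1                        ≡⟨ cong (λ k → (countAbove b l + k) ∸ 1) only-peak ⟨
  (countAbove b l + largerBefore b (m ∷ r)) ∸ 1   ∎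
  where
  open ≡-Reasoning
  b<m = All.lookup r<m b∈r
  none-in-r : largerBefore b r ≡ 0
  none-in-r = largerBefore-sorted r (DominatedBelowLater⇒sortedBelowPeak l dom r<m) b∈r
  none-in-Sr : largerBefore b (Sr ++ m ∷ []) ≡ 0
  none-in-Sr = trans (largerBefore-++-∈ Sr _ (∈-resp-↭ (↭-sym Sr↭r) b∈r))
                     (trans (ih-r b∈r) (cong (_∸ 1) none-in-r))
  only-peak : largerBefore b (m ∷ r) ≡ 1
  only-peak = begin
    largerBefore b (m ∷ r)                    ≡⟨ largerBefore-++-∉ (m ∷ []) r (λ { (here refl) → <-irrefl refl b<m }) ⟩
    countAbove b (m ∷ []) + largerBefore b r  ≡⟨ cong₂ _+_ only-m none-in-r ⟩
    1                                         ∎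
    where
    only-m : countAbove b (m ∷ []) ≡ 1
    only-m = cong length (filter-accept (b <?_) {xs = []} b<m)

largerBefore-peak : ∀ {Sl Sr} → DominatedBelowLater (l ++ m ∷ r) →
  All (_≤ m) l → All (_< m) r → Sl ↭ l → Sr ↭ r →
  (∀ {b} → b ∈ l → largerBefore b Sl ≡ largerBefore b l ∸ 1) →
  (∀ {b} → b ∈ r → largerBefore b Sr ≡ largerBefore b r ∸ 1) →
  b ∈ l ++ m ∷ r → largerBefore b (Sl ++ Sr ++ m ∷ []) ≡ largerBefore b (l ++ m ∷ r) ∸ 1
largerBefore-peak {l} {m} {r} {b} {Sl} {Sr} dom l≤m r<m Sl↭l Sr↭r ih-l ih-r b∈ with b ∈? l | ∈-++⁻ l b∈
... | yes b∈l | _ = begin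
  largerBefore b (Sl ++ Sr ++ m ∷ [])  ≡⟨ largerBefore-++-∈ Sl _ (∈-resp-↭ (↭-sym Sl↭l) b∈l) ⟩
  largerBefore b Sl                    ≡⟨ ih-l b∈l ⟩
  largerBefore b l ∸ 1                 ≡⟨ cong (_∸ 1) (largerBefore-++-∈ l _ b∈l) ⟨
  largerBefore b (l ++ m ∷ r) ∸ 1      ∎
  where open ≡-Reasoning
... | no b∉l | inj₁ b∈l = ⊥-elim (b∉l b∈l)
... | no b∉l | inj₂ b∈mr = begin
  largerBefore b (Sl ++ Sr ++ m ∷ [])              ≡⟨ largerBefore-++-∉ Sl _ (b∉l ∘ ∈-resp-↭ Sl↭l) ⟩
  countAbove b Sl + largerBefore b (Sr ++ m ∷ [])  ≡⟨ cong (_+ _) (count-↭ (b <?_) Sl↭l) ⟩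
  countAbove b l + largerBefore b (Sr ++ m ∷ [])   ≡⟨ largerBefore-peak-right dom l≤m r<m Sr↭r ih-r b∈mr ⟩
  (countAbove b l + largerBefore b (m ∷ r)) ∸ 1    ≡⟨ cong (_∸ 1) (largerBefore-++-∉ l _ b∉l) ⟨
  largerBefore b (l ++ m ∷ r) ∸ 1                  ∎
  where open ≡-Reasoning

DominatedBelowLater-peak : ∀ {Sl Sr} → DominatedBelowLater (l ++ m ∷ r) → All (_< m) r →
  Sl ↭ l → Sr ↭ r → Unique Sl → DominatedBelowLater Sl → AllPairs _≤_ Sr →
  (∀ {b} → b ∈ l → largerBefore b Sl ≡ largerBefore b l ∸ 1) →
  DominatedBelowLater (Sl ++ Sr ++ m ∷ [])
DominatedBelowLater-peak {l} {m} {r} {Sl} {Sr} dom r<m Sl↭l Sr↭r Sl-unique Sl-dom Sr↗ ih-l =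
  DominatedBelowLater-++ Sl Sl-dom cross
    (AllPairsₚ.++⁺ Sr↗ ([] ∷ []) (All.map (λ y<m → <⇒≤ y<m ∷ []) (All-resp-↭ (↭-sym Sr↭r) r<m)))
  where
  cross : ∀ p b s → Sl ≡ p ++ b ∷ s → Any (b <_) p → All (b ≤_) (Sr ++ m ∷ [])
  cross p b s refl larger = Allₚ.++⁺ (All-resp-↭ (↭-sym Sr↭r) (All.tail after-b)) (All.head after-b ∷ [])
    where
    b∈l : b ∈ l
    b∈l = ∈-resp-↭ Sl↭l (∈-++⁺ʳ p (here refl))
    dominated-in-Sl : 0 < largerBefore b (p ++ b ∷ s)
    dominated-in-Sl =
      subst (0 <_) (sym (largerBefore-++-∷ p s (Unique-∷⁻ p Sl-unique))) (Any⇒count>0 (b <?_) larger)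
    dominated-in-l : 0 < largerBefore b l
    dominated-in-l = <-≤-trans (subst (0 <_) (ih-l b∈l) dominated-in-Sl) (m∸n≤m _ 1)
    after-b : All (b ≤_) (m ∷ r)
    after-b with dominated-split l b∈l dominated-in-l
    ... | p′ , s′ , refl , larger′ =
      Allₚ.++⁻ʳ s′ (dom p′ b (s′ ++ m ∷ r) (++-assoc p′ (b ∷ s′) (m ∷ r)) larger′)

stackSortF-↭ : ∀ f w → All (0 <_) w → stackSortF f w ↭ w
stackSortF-↭ zero    w        _   = ↭-refl
stackSortF-↭ (suc f) []       _   = ↭-refl
stackSortF-↭ (suc f) (x ∷ xs) pos =
  ↭-trans (peak-↭ (stackSortF-↭ f left (All-left pos)) (stackSortF-↭ f right (All-right pos)))
          (↭-reflexive (sym split))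
  where open PeakSplit (peakSplit x xs pos)

largerBefore-stackSortF : ∀ f w → length w ≤ f → All (0 <_) w → DominatedBelowLater w →
  b ∈ w → largerBefore b (stackSortF f w) ≡ largerBefore b w ∸ 1
largerBefore-stackSortF {b} (suc f) (x ∷ xs) w≤ pos dom b∈ =
  trans (largerBefore-peak (subst DominatedBelowLater split dom) left≤peak right<peak
           (stackSortF-↭ f left (All-left pos)) (stackSortF-↭ f right (All-right pos))
           (ih left (left-shorter w≤) (All-left pos) (dominated-left dom))
           (ih right (right-shorter w≤) (All-right pos) (dominated-right dom))
           (subst (_ ∈_) split b∈))
        (cong (λ v → largerBefore b v ∸ 1) (sym split))
  where
  open PeakSplit (peakSplit x xs pos)
  ih : ∀ v → length v ≤ f → All (0 <_) v → DominatedBelowLater v →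
    ∀ {c} → c ∈ v → largerBefore c (stackSortF f v) ≡ largerBefore c v ∸ 1
  ih v v≤ v-pos v-dom = largerBefore-stackSortF f v v≤ v-pos v-dom

stackSortF-sorted : ∀ f w → length w ≤ f → All (0 <_) w → Unique w → AllPairs _≤_ w →
  AllPairs _≤_ (stackSortF f w)
stackSortF-sorted f w w≤ pos unique w↗ =
  largerBefore≡0⇒sorted _ (Unique-resp-↭ (↭-sym S↭w) unique) λ b∈ →
    let b∈w = ∈-resp-↭ S↭w b∈ in
    trans (largerBefore-stackSortF f w w≤ pos (sorted⇒DominatedBelowLater w w↗) b∈w)
          (cong (_∸ 1) (largerBefore-sorted w w↗ b∈w))
  where S↭w = stackSortF-↭ f w pos

DominatedBelowLater-stackSortF : ∀ f w → length w ≤ f → All (0 <_) w → Unique w → DominatedBelowLater w →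
  DominatedBelowLater (stackSortF f w)
DominatedBelowLater-stackSortF zero    w        _  _   _      dom = dom
DominatedBelowLater-stackSortF (suc f) []       _  _   _      dom = dom
DominatedBelowLater-stackSortF (suc f) (x ∷ xs) w≤ pos unique dom =
  DominatedBelowLater-peak dom′ right<peak Sl↭l Sr↭r
    (Unique-resp-↭ (↭-sym Sl↭l) (Unique-left unique))
    (DominatedBelowLater-stackSortF f left (left-shorter w≤) (All-left pos) (Unique-left unique) (dominated-left dom))
    (stackSortF-sorted f right (right-shorter w≤) (All-right pos) (Unique-right unique)
      (DominatedBelowLater⇒sortedBelowPeak left dom′ right<peak))
    (largerBefore-stackSortF f left (left-shorter w≤) (All-left pos) (dominated-left dom))
  where
  open PeakSplit (peakSplit x xs pos)
  dom′ = subst DominatedBelowLater split dom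
  Sl↭l = stackSortF-↭ f left (All-left pos)
  Sr↭r = stackSortF-↭ f right (All-right pos)

record Word321 (w : List ℕ) : Set where
  field
    positive : All (0 <_) w
    distinct : Unique w
    dominated-below-later : DominatedBelowLater w

S-↭ : All (0 <_) w → S w ↭ w
S-↭ {w} = stackSortF-↭ (length w) w

Word321-S : Word321 w → Word321 (S w)
Word321-S {w} w321 = record
  { positive              = All-resp-↭ (↭-sym (S-↭ positive)) positive
  ; distinct              = Unique-resp-↭ (↭-sym (S-↭ positive)) distinct
  ; dominated-below-later = DominatedBelowLater-stackSortF (length w) w ≤-refl positive distinct dominated-below-later
  }
  where open Word321 w321

largerBefore-S : Word321 w → b ∈ w → largerBefore b (S w) ≡ largerBefore b w ∸ 1
largerBefore-S {w} w321 = largerBefore-stackSortF (length w) w ≤-refl positive dominated-below-later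
  where open Word321 w321

iterate-S-↭ : ∀ t → All (0 <_) w → iterate t S w ↭ w
iterate-S-↭ zero    _   = ↭-refl
iterate-S-↭ (suc t) pos = ↭-trans (iterate-S-↭ t (All-resp-↭ (↭-sym (S-↭ pos)) pos)) (S-↭ pos)

largerBefore-iterate-S : ∀ t → Word321 w → b ∈ w → largerBefore b (iterate t S w) ≡ largerBefore b w ∸ t
largerBefore-iterate-S zero    _    _  = refl
largerBefore-iterate-S {w} {b} (suc t) w321 b∈ = begin
  largerBefore b (iterate t S (S w))  ≡⟨ largerBefore-iterate-S t (Word321-S w321) b∈Sw ⟩
  largerBefore b (S w) ∸ t            ≡⟨ cong (_∸ t) (largerBefore-S w321 b∈) ⟩
  largerBefore b w ∸ 1 ∸ t            ≡⟨ ∸-+-assoc (largerBefore b w) 1 t ⟩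
  largerBefore b w ∸ suc t            ∎
  where
  open ≡-Reasoning
  open Word321 w321
  b∈Sw = ∈-resp-↭ (↭-sym (S-↭ positive)) b∈

S321⇒Word321 : S321 n w → Word321 w
S321⇒Word321 {w = w} (perm , avoids) = record
  { positive              = All-resp-↭ (↭-sym perm) (All.tabulate (proj₁ ∘ ∈-idPerm⁻))
  ; distinct              = Unique-resp-↭ (↭-sym perm) (AllPairs.map <⇒≢ (idPerm-strictlySorted _))
  ; dominated-below-later = Avoids321⇒DominatedBelowLater w avoids
  }

StackSortable⇔largerBefore≤ : ∀ t → IsPerm n w → Word321 w →
  StackSortable n t w ⇔ All (λ b → largerBefore b w ≤ t) w
StackSortable⇔largerBefore≤ {n} {w} t perm w321 = mk⇔ to from
  where
  open Word321 w321
  Stw↭w : iterate t S w ↭ w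
  Stw↭w = iterate-S-↭ t positive
  id↗ : AllPairs _≤_ (idPerm n)
  id↗ = AllPairs.map <⇒≤ (idPerm-strictlySorted n)
  to : iterate t S w ≡ idPerm n → All (λ b → largerBefore b w ≤ t) w
  to Stw≡id = All.tabulate λ {b} b∈ → m∸n≡0⇒m≤n (begin
    largerBefore b w ∸ t            ≡⟨ largerBefore-iterate-S t w321 b∈ ⟨
    largerBefore b (iterate t S w)  ≡⟨ cong (largerBefore b) Stw≡id ⟩
    largerBefore b (idPerm n)       ≡⟨ largerBefore-sorted _ id↗ (∈-resp-↭ perm b∈) ⟩
    0                               ∎)
    where open ≡-Reasoning
  from : All (λ b → largerBefore b w ≤ t) w → iterate t S w ≡ idPerm n
  from bounded = sorted-↭⇒≡ Stw↗ id↗ (↭-trans Stw↭w perm)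
    where
    Stw↗ : AllPairs _≤_ (iterate t S w)
    Stw↗ = largerBefore≡0⇒sorted _ (Unique-resp-↭ (↭-sym Stw↭w) distinct) λ b∈ →
      let b∈w = ∈-resp-↭ Stw↭w b∈ in
      trans (largerBefore-iterate-S t w321 b∈w) (m≤n⇒m∸n≡0 (All.lookup bounded b∈w))

rmiGap : ℕ → ℕ → List ℕ → ℕ
rmiGap j x r = if isRmin x r then j ∸ x else 0

mlwFrom≤⇔ : ∀ {f : ℕ → ℕ} j s → (∀ q x r → s ≡ q ++ x ∷ r → rmiGap (length q + j) x r ≡ f x) →
  mlwFrom j s ≤ t ⇔ All (λ x → f x ≤ t) s
mlwFrom≤⇔ j []      _   = mk⇔ (λ _ → []) (λ _ → z≤n)
mlwFrom≤⇔ {t} j (x ∷ s) gap = mk⇔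
  (λ ≤t → subst (_≤ t) (gap [] x s refl) (m⊔n≤o⇒m≤o _ _ ≤t) ∷ Equivalence.to ih (m⊔n≤o⇒n≤o _ _ ≤t))
  (λ { (fx≤t ∷ rest≤t) → ⊔-lub (subst (_≤ t) (sym (gap [] x s refl)) fx≤t) (Equivalence.from ih rest≤t) })
  where
  ih = mlwFrom≤⇔ (suc j) s λ q y r eq →
    trans (cong (λ k → rmiGap k y r) (+-suc (length q) j)) (gap (x ∷ q) y r (cong (x ∷_) eq))

isRmin≡all? : ∀ x s → isRmin x s ≡ does (all? (x <?_) s)
isRmin≡all? x []      = refl
isRmin≡all? x (y ∷ s) = cong ((x <ᵇ y) ∧_) (isRmin≡all? x s)

m∸1+n+1∸m≡n : ∀ x c → 0 < x → ((x ∸ 1) + c + 1) ∸ x ≡ c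
m∸1+n+1∸m≡n (suc x) c _ = trans (cong (_∸ suc x) (+-comm (x + c) 1)) (m+n∸m≡n x c)

rmiGap≡largerBefore : ∀ q x r → IsPerm n (q ++ x ∷ r) → Word321 (q ++ x ∷ r) →
  rmiGap (length q + 1) x r ≡ largerBefore x (q ++ x ∷ r)
rmiGap≡largerBefore {n} q x r perm w321 with all? (x <?_) r | isRmin≡all? x r
... | yes x<r | rmin = begin
  rmiGap (length q + 1) x r                    ≡⟨ cong (λ c → if c then length q + 1 ∸ x else 0) rmin ⟩
  (length q + 1) ∸ x                           ≡⟨ cong (λ k → (k + 1) ∸ x) (length≡countBelow+countAbove q x∉q) ⟩
  (countBelow x q + countAbove x q + 1) ∸ x    ≡⟨ cong (λ k → (k + countAbove x q + 1) ∸ x) below-q ⟩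
  ((x ∸ 1) + countAbove x q + 1) ∸ x           ≡⟨ m∸1+n+1∸m≡n x _ (proj₁ (∈-idPerm⁻ x∈id)) ⟩
  countAbove x q                               ≡⟨ largerBefore-++-∷ q r x∉q ⟨
  largerBefore x (q ++ x ∷ r)                  ∎
  where
  open ≡-Reasoning
  open Word321 w321
  x∉q = Unique-∷⁻ q distinct
  x∈id = ∈-resp-↭ perm (∈-++⁺ʳ q (here refl))
  -- x is a right-to-left minimum, so all x − 1 smaller letters lie in q.
  below-q : countBelow x q ≡ x ∸ 1
  below-q = begin
    countBelow x q                                ≡⟨ +-identityʳ _ ⟨
    countBelow x q + 0                            ≡⟨ cong (countBelow x q +_) none-below-from-x ⟨
    countBelow x q + countBelow x (x ∷ r)         ≡⟨ count-++ (_<? x) q (x ∷ r) ⟨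
    countBelow x (q ++ x ∷ r)                     ≡⟨ count-↭ (_<? x) perm ⟩
    countBelow x (idPerm n)                       ≡⟨ countBelow-idPerm n (m≤n⇒m≤1+n (proj₂ (∈-idPerm⁻ x∈id))) ⟩
    x ∸ 1                                         ∎
    where
    none-below-from-x : countBelow x (x ∷ r) ≡ 0
    none-below-from-x = count-none (_<? x) (<-irrefl refl ∷ All.map <⇒≯ x<r)
... | no ¬x<r | not-rmin with find (Allₚ.¬All⇒Any¬ (x <?_) r ¬x<r)
...   | y , y∈r , x≮y =
  trans (cong (λ c → if c then length q + 1 ∸ x else 0) not-rmin) (sym (n≤0⇒n≡0 (≮⇒≥ dominated⇒⊥)))
  where
  open Word321 w321
  x∉q = Unique-∷⁻ q distinct
  y<x : y < x
  y<x = ≤∧≢⇒< (≮⇒≥ x≮y) (λ y≡x → All.lookup (AllPairs.head (AllPairs-++⁻ʳ q distinct)) y∈r (sym y≡x))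
  dominated⇒⊥ : ¬ 0 < largerBefore x (q ++ x ∷ r)
  dominated⇒⊥ pos = <⇒≱ y<x (All.lookup (dominated-below-later q x r refl larger) y∈r)
    where larger = count>0⇒Any (x <?_) q (subst (0 <_) (largerBefore-++-∷ q r x∉q) pos)

mlw≤⇔ : IsPerm n w → Word321 w → mlw w ≤ t ⇔ All (λ b → largerBefore b w ≤ t) w
mlw≤⇔ {n} {w} perm w321 = mlwFrom≤⇔ 1 w λ q x r eq →
  subst (λ v → rmiGap (length q + 1) x r ≡ largerBefore x v) (sym eq)
        (rmiGap≡largerBefore q x r (subst (IsPerm n) eq perm) (subst Word321 eq w321))

lemma2p2 : (n t : ℕ) → t ≥ 1 → (π : List ℕ) → S321 n π →
    (StackSortable n t π → mlw π ≤ t) × (mlw π ≤ t → StackSortable n t π)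
lemma2p2 n t _ π π∈S321@(perm , _) = Equivalence.to sortable⇔mlw , Equivalence.from sortable⇔mlw
  where
  π321 = S321⇒Word321 π∈S321
  sortable⇔mlw : StackSortable n t π ⇔ mlw π ≤ t
  sortable⇔mlw = ⇔.trans (StackSortable⇔largerBefore≤ t perm π321) (⇔.sym (mlw≤⇔ perm π321))
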